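{- A morphism $f:P\to Q$ of $\mathbf{rPres}$ is a trivial cofibration (i.e. belongs to $\mathcal{C}\cap\mathcal{W}$) if and only if: $f$ is a monomorphism; for every $a\in Q_1$ there exists $u\in P_1^*$ with $f^*(u)\sim_Q a$; and for all $u,v\in P_1^*$ with $f^*(u)\sim_Q f^*(v)$ we have $u\sim_P v$.
   Context: $\mathbf{rPres}$ is the category of reflexive presentations of monoids (generators $P_1$, relations $P_2\subseteq P_1^*\times P_1^*$ containing $u\to u$ for every word; morphisms are maps on generators sending relations to relations); $\sim_P$ denotes the congruence on $P_1^*$ generated by $P_2$. $\mathcal{W}$ is the class of morphisms inducing an isomorphism of presented monoids $P_1^*/\sim_P\to Q_1^*/\sim_Q$. With $G$ the presentation with one generator and no relation, $G^n$ the one with $n$ generators and no relation, and $R^{m,n}$ the one with generators $a_1,\dots,a_{m+n}$ and relation $a_1\cdots a_m\to a_{m+1}\cdots a_{m+n}$, $\mathcal{I}$ is the class of inclusions $\emptyset\to G$ and $G^{m+n}\to R^{m,n}$, and $\mathcal{C}$ is the class of morphisms having the left lifting property with respect to every morphism that has the right lifting property with respect to all of $\mathcal{I}$ (these are exactly the monomorphisms). -}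

module Defs where

open import Level using (0ℓ)
open import Data.Nat using (ℕ; _+_)
open import Data.Fin using (Fin; _↑ˡ_; _↑ʳ_)
open import Data.List using (List; []; _∷_; map; _++_; [_])
open import Data.List.Base using (allFin)
open import Data.Empty using (⊥)
open import Data.Unit using (⊤)
open import Data.Sum using (_⊎_)
open import Data.Product using (Σ; ∃; _×_; _,_)
open import Relation.Binary.PropositionalEquality using (_≡_)
open import Function using (_∘_)
open import Function.Definitions using (Congruent; Bijective)

-- Reflexive presentations of monoids.
-- Generators P₁ : Set, relations P₂ : a predicate on pairs of words
-- (a subset of P₁* × P₁*), required to contain u → u for every word u.

record RPres : Set₁ where
  field
    Gen   : Set
    Rel   : List Gen → List Gen → Set
    reflR : ∀ u → Rel u u
open RPres public

record Hom (P Q : RPres) : Set where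
  field
    gen : Gen P → Gen Q
    rel : ∀ {u v} → Rel P u v → Rel Q (map gen u) (map gen v)
open Hom public

_* : ∀ {P Q} → Hom P Q → List (Gen P) → List (Gen Q)
(f *) = map (gen f)

open import Data.List.Properties using (map-∘)
open import Relation.Binary.PropositionalEquality using (subst₂; sym)

_∘H_ : ∀ {P Q R} → Hom Q R → Hom P Q → Hom P R
_∘H_ {P} {Q} {R} g f = record { gen = gen g ∘ gen f ; rel = tr }
  where
  tr : ∀ {u v} → Rel P u v → Rel R (map (gen g ∘ gen f) u) (map (gen g ∘ gen f) v)
  tr {u} {v} r = subst₂ (Rel R) (sym (map-∘ u)) (sym (map-∘ v)) (rel g (rel f r))

-- Equality of morphisms: a morphism is determined by its action on
-- generators (relations form a subset).
_≈H_ : ∀ {P Q} → Hom P Q → Hom P Q → Set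
f ≈H g = ∀ a → gen f a ≡ gen g a

data _⊢_∼_ (P : RPres) : List (Gen P) → List (Gen P) → Set where
  step   : ∀ x y {u v} → Rel P u v → P ⊢ (x ++ (u ++ y)) ∼ (x ++ (v ++ y))
  ∼refl  : ∀ {u} → P ⊢ u ∼ u
  ∼sym   : ∀ {u v} → P ⊢ u ∼ v → P ⊢ v ∼ u
  ∼trans : ∀ {u v w} → P ⊢ u ∼ v → P ⊢ v ∼ w → P ⊢ u ∼ w

Mono : ∀ {P Q} → Hom P Q → Set₁
Mono {P} f = ∀ (Z : RPres) (g h : Hom Z P) → (f ∘H g) ≈H (f ∘H h) → g ≈H h

-- The class 𝒲: f induces an isomorphism of presented monoids
-- P₁*/∼_P → Q₁*/∼_Q, i.e. f* is a well-defined bijection of the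
-- quotient setoids (it is automatically a monoid morphism since
-- f*(u ++ v) = f* u ++ f* v).

InW : ∀ {P Q} → Hom P Q → Set
InW {P} {Q} f =
  Congruent (P ⊢_∼_) (Q ⊢_∼_) (f *) × Bijective (P ⊢_∼_) (Q ⊢_∼_) (f *)

LP : ∀ {A B X Y} → Hom A B → Hom X Y → Set
LP {A} {B} {X} {Y} i p =
  ∀ (u : Hom A X) (v : Hom B Y) → (p ∘H u) ≈H (v ∘H i) →
  Σ (Hom B X) λ h → ((h ∘H i) ≈H u) × ((p ∘H h) ≈H v)

Free : Set → RPres
Free A = record { Gen = A ; Rel = _≡_ ; reflR = λ u → _≡_.refl }

EmptyP : RPres
EmptyP = Free ⊥

G : RPres
G = Free ⊤

G^ : ℕ → RPres
G^ n = Free (Fin n)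

-- R^{m,n}: generators a₁ … a_{m+n}, relation a₁⋯a_m → a_{m+1}⋯a_{m+n}
-- (plus the reflexive ones).
lhsR : ∀ m n → List (Fin (m + n))
lhsR m n = map (_↑ˡ n) (allFin m)

rhsR : ∀ m n → List (Fin (m + n))
rhsR m n = map (m ↑ʳ_) (allFin n)

R : ℕ → ℕ → RPres
R m n = record
  { Gen = Fin (m + n)
  ; Rel = λ u v → (u ≡ v) ⊎ ((u ≡ lhsR m n) × (v ≡ rhsR m n))
  ; reflR = λ u → Data.Sum.inj₁ _≡_.refl
  }
  where import Data.Sum

ι₀ : Hom EmptyP G
ι₀ = record { gen = λ () ; rel = λ { _≡_.refl → _≡_.refl } }

ι : ∀ m n → Hom (G^ (m + n)) (R m n)
ι m n = record { gen = λ a → a ; rel = λ { {u} _≡_.refl → Data.Sum.inj₁ _≡_.refl } }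
  where import Data.Sum

RLP-I : ∀ {X Y} → Hom X Y → Set
RLP-I p = LP ι₀ p × (∀ m n → LP (ι m n) p)

InC : ∀ {P Q} → Hom P Q → Set₁
InC f = ∀ (X Y : RPres) (p : Hom X Y) → RLP-I p → LP f p

-- Lifting against ∅ → G makes a morphism p with the right lifting property
-- against ℐ surjective on generators, and lifting against G^{m+n} → R^{m,n}
-- makes it reflect relations: Rel Y (p* s) (p* t) implies Rel X s t.
-- Hence a monomorphism f lifts against p: send a generator in the image of f (a
-- case split that needs excluded middle) to the image of its unique preimage,
-- any other generator b to some preimage of v b; relations are preserved since p reflects them.
-- Conversely a cofibration is mono because it lifts against the map from the
-- chaotic presentation on P₁ ⊎ 1 to the chaotic one on 1.  The conditions on
-- words say precisely that f* is injective and surjective on ∼-classes.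

module Submission where

open import Defs
open import Level using (0ℓ)
open import Axiom.ExcludedMiddle using (ExcludedMiddle)
open import Data.List using ([_])
open import Data.Product using (Σ; _×_)
open import Function.Bundles using (_⇔_)

open import Data.Empty using (⊥-elim)
open import Data.Fin using (Fin; splitAt; _↑ˡ_; _↑ʳ_)
open import Data.Fin.Properties using (splitAt-↑ˡ; splitAt-↑ʳ)
open import Data.List using (List; []; _∷_; map; _++_; length; tabulate; lookup; allFin)
open import Data.List.Properties
  using (map-++; map-cong; map-∘; ++-assoc; tabulate-cong; tabulate-lookup; map-tabulate)
open import Data.Nat using (_+_)
open import Data.Product using (_,_; proj₁; proj₂)
open import Data.Sum using (_⊎_; inj₁; inj₂; [_,_]′)
open import Data.Sum.Properties using (inj₁-injective)
open import Data.Unit using (⊤; tt)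
open import Function using (_∘_; id)
open import Function.Bundles using (mk⇔)
open import Function.Consequences using (strictlySurjective⇒surjective)
open import Relation.Nullary using (yes; no)
open import Relation.Binary.PropositionalEquality hiding ([_])

private
  variable
    A B : Set

∼-++ʳ : ∀ {P} {u u′} w → P ⊢ u ∼ u′ → P ⊢ (u ++ w) ∼ (u′ ++ w)
∼-++ʳ {P} w (step x y {u} {v} r) =
  subst₂ (P ⊢_∼_) (reassoc u) (reassoc v) (step x (y ++ w) r)
  where
  reassoc : ∀ z → x ++ (z ++ (y ++ w)) ≡ (x ++ (z ++ y)) ++ w
  reassoc z = sym (trans (++-assoc x (z ++ y) w) (cong (x ++_) (++-assoc z y w)))
∼-++ʳ w ∼refl         = ∼refl
∼-++ʳ w (∼sym p)      = ∼sym (∼-++ʳ w p)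
∼-++ʳ w (∼trans p q)  = ∼trans (∼-++ʳ w p) (∼-++ʳ w q)

∼-++ˡ : ∀ {P} w {u u′} → P ⊢ u ∼ u′ → P ⊢ (w ++ u) ∼ (w ++ u′)
∼-++ˡ {P} w (step x y {u} {v} r) =
  subst₂ (P ⊢_∼_) (++-assoc w x (u ++ y)) (++-assoc w x (v ++ y)) (step (w ++ x) y r)
∼-++ˡ w ∼refl         = ∼refl
∼-++ˡ w (∼sym p)      = ∼sym (∼-++ˡ w p)
∼-++ˡ w (∼trans p q)  = ∼trans (∼-++ˡ w p) (∼-++ˡ w q)

∼-++ : ∀ {P} {u u′ w w′} → P ⊢ u ∼ u′ → P ⊢ w ∼ w′ → P ⊢ (u ++ w) ∼ (u′ ++ w′)
∼-++ {u′ = u′} {w = w} p q = ∼trans (∼-++ʳ w p) (∼-++ˡ u′ q)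

*-cong : ∀ {P Q} (f : Hom P Q) {u v} → P ⊢ u ∼ v → Q ⊢ (f *) u ∼ (f *) v
*-cong {Q = Q} f (step x y {u} {v} r) =
  subst₂ (Q ⊢_∼_) (map-step u) (map-step v) (step ((f *) x) ((f *) y) (rel f r))
  where
  map-step : ∀ z → (f *) x ++ ((f *) z ++ (f *) y) ≡ (f *) (x ++ (z ++ y))
  map-step z = sym (trans (map-++ (gen f) x (z ++ y)) (cong ((f *) x ++_) (map-++ (gen f) z y)))
*-cong f ∼refl        = ∼refl
*-cong f (∼sym p)     = ∼sym (*-cong f p)
*-cong f (∼trans p q) = ∼trans (*-cong f p) (*-cong f q)

*-strictlySurjective : ∀ {P Q} (f : Hom P Q) →
  (∀ (a : Gen Q) → Σ _ λ u → Q ⊢ (f *) u ∼ [ a ]) →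
  ∀ (w : List (Gen Q)) → Σ (List (Gen P)) λ u → Q ⊢ (f *) u ∼ w
*-strictlySurjective f surj [] = [] , ∼refl
*-strictlySurjective {Q = Q} f surj (a ∷ w)
  with surj a | *-strictlySurjective f surj w
... | u , fu∼a | u′ , fu′∼w =
  u ++ u′ , subst (λ z → Q ⊢ z ∼ (a ∷ w)) (sym (map-++ (gen f) u u′)) (∼-++ fu∼a fu′∼w)

constHom : ∀ {P} → Gen P → Hom G P
constHom {P} a = record { gen = λ _ → a ; rel = λ { refl → reflR P _ } }

initialHom : ∀ {P} → Hom EmptyP P
initialHom {P} = record { gen = λ () ; rel = λ { refl → reflR P _ } }

Mono⇒gen-injective : ∀ {P Q} (f : Hom P Q) → Mono f →
  ∀ {a a′} → gen f a ≡ gen f a′ → a ≡ a′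
Mono⇒gen-injective f mono {a} {a′} e = mono G (constHom a) (constHom a′) (λ _ → e) tt

tabulate-map-lhsR : ∀ {m n} (g : Fin (m + n) → A) → map g (lhsR m n) ≡ tabulate (g ∘ (_↑ˡ n))
tabulate-map-lhsR {m = m} g = trans (sym (map-∘ (allFin m))) (map-tabulate id _)

tabulate-map-rhsR : ∀ {m n} (g : Fin (m + n) → A) → map g (rhsR m n) ≡ tabulate (g ∘ (m ↑ʳ_))
tabulate-map-rhsR {n = n} g = trans (sym (map-∘ (allFin n))) (map-tabulate id _)

-- The pair of words (s , t) as a single family indexed like the generators of R^{|s|,|t|}.
lookup-pair : (s t : List A) → Fin (length s + length t) → A
lookup-pair s t = [ lookup s , lookup t ]′ ∘ splitAt (length s)

map-lookup-pair-lhsR : ∀ (s t : List A) {g} → g ≗ lookup-pair s t →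
  map g (lhsR (length s) (length t)) ≡ s
map-lookup-pair-lhsR s t {g} g≗ = begin
  map g (lhsR (length s) (length t)) ≡⟨ tabulate-map-lhsR g ⟩
  tabulate (g ∘ (_↑ˡ length t))      ≡⟨ tabulate-cong (λ i → trans (g≗ _) (on-left i)) ⟩
  tabulate (lookup s)                ≡⟨ tabulate-lookup s ⟩
  s                                  ∎
  where
  open ≡-Reasoning
  on-left : ∀ i → lookup-pair s t (i ↑ˡ length t) ≡ lookup s i
  on-left i rewrite splitAt-↑ˡ (length s) i (length t) = refl

map-lookup-pair-rhsR : ∀ (s t : List A) {g} → g ≗ lookup-pair s t →
  map g (rhsR (length s) (length t)) ≡ t
map-lookup-pair-rhsR s t {g} g≗ = begin
  map g (rhsR (length s) (length t)) ≡⟨ tabulate-map-rhsR g ⟩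
  tabulate (g ∘ (length s ↑ʳ_))      ≡⟨ tabulate-cong (λ i → trans (g≗ _) (on-right i)) ⟩
  tabulate (lookup t)                ≡⟨ tabulate-lookup t ⟩
  t                                  ∎
  where
  open ≡-Reasoning
  on-right : ∀ i → lookup-pair s t (length s ↑ʳ i) ≡ lookup t i
  on-right i rewrite splitAt-↑ʳ (length s) (length t) i = refl

module RLP-I-Properties {X Y : RPres} (p : Hom X Y) (rlp : RLP-I p) where

  gen-surjective : ∀ (y : Gen Y) → Σ (Gen X) λ x → gen p x ≡ y
  gen-surjective y with proj₁ rlp initialHom (constHom y) (λ ())
  ... | h , _ , ph≈ = gen h tt , ph≈ tt

  rel-reflecting : ∀ s t → Rel Y ((p *) s) ((p *) t) → Rel X s t
  rel-reflecting s t r =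
    subst₂ (Rel X) (map-lookup-pair-lhsR s t h≗) (map-lookup-pair-rhsR s t h≗)
      (rel h (inj₂ (refl , refl)))
    where
    m = length s
    n = length t
    w = lookup-pair s t

    wordsHom : Hom (G^ (m + n)) X
    wordsHom = record { gen = w ; rel = λ { refl → reflR X _ } }

    image-rel : Rel Y (map (gen p ∘ w) (lhsR m n)) (map (gen p ∘ w) (rhsR m n))
    image-rel = subst₂ (Rel Y)
      (trans (cong (p *) (sym (map-lookup-pair-lhsR s t λ _ → refl))) (sym (map-∘ (lhsR m n))))
      (trans (cong (p *) (sym (map-lookup-pair-rhsR s t λ _ → refl))) (sym (map-∘ (rhsR m n))))
      r

    relationHom : Hom (R m n) Y
    relationHom = record
      { gen = gen p ∘ w
      ; rel = λ { (inj₁ refl) → reflR Y _ ; (inj₂ (refl , refl)) → image-rel } }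

    lift = proj₂ rlp m n wordsHom relationHom (λ _ → refl)
    h = proj₁ lift
    h≗ : gen h ≗ w
    h≗ = proj₁ (proj₂ lift)

Chaotic : Set → RPres
Chaotic A = record { Gen = A ; Rel = λ _ _ → ⊤ ; reflR = λ _ → tt }

toChaotic : ∀ {P} → (Gen P → A) → Hom P (Chaotic A)
toChaotic g = record { gen = g ; rel = λ _ → tt }

chaotic-RLP-I : (g : A → B) → (∀ b → Σ A λ a → g a ≡ b) → RLP-I (toChaotic {P = Chaotic A} g)
chaotic-RLP-I g surj =
    (λ u v _ → toChaotic (λ _ → proj₁ (surj (gen v tt))) , (λ ()) , (λ _ → proj₂ (surj (gen v tt))))
  , (λ m n u v sq → toChaotic (gen u) , (λ _ → refl) , sq)

InC⇒Mono : ∀ {P Q} (f : Hom P Q) → InC f → Mono f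
InC⇒Mono {P} {Q} f cof Z g g′ fg≈fg′ a
  with cof (Chaotic (Gen P ⊎ ⊤)) (Chaotic ⊤) (toChaotic _) fibration
           (toChaotic inj₁) (toChaotic _) (λ _ → refl)
  where
  -- The extra point keeps the map onto the terminal presentation surjective when P₁ is empty.
  fibration : RLP-I (toChaotic {P = Chaotic (Gen P ⊎ ⊤)} (λ _ → tt))
  fibration = chaotic-RLP-I _ (λ _ → inj₂ tt , refl)
... | h , hf≈inj₁ , _ =
  inj₁-injective (trans (sym (hf≈inj₁ (gen g a))) (trans (cong (gen h) (fg≈fg′ a)) (hf≈inj₁ (gen g′ a))))

module MonoLift (em : ExcludedMiddle 0ℓ) {P Q : RPres} (f : Hom P Q) (mono : Mono f)
                {X Y : RPres} (p : Hom X Y) (rlp : RLP-I p)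
                (u : Hom P X) (v : Hom Q Y) (sq : (p ∘H u) ≈H (v ∘H f)) where
  open RLP-I-Properties p rlp

  lift-gen : Gen Q → Gen X
  lift-gen b with em {Σ (Gen P) λ a → gen f a ≡ b}
  ... | yes (a , _) = gen u a
  ... | no _        = proj₁ (gen-surjective (gen v b))

  lift-gen-over-v : ∀ b → gen p (lift-gen b) ≡ gen v b
  lift-gen-over-v b with em {Σ (Gen P) λ a → gen f a ≡ b}
  ... | yes (a , fa≡b) = trans (sq a) (cong (gen v) fa≡b)
  ... | no _           = proj₂ (gen-surjective (gen v b))

  lift-gen-extends-u : ∀ a → lift-gen (gen f a) ≡ gen u a
  lift-gen-extends-u a with em {Σ (Gen P) λ a′ → gen f a′ ≡ gen f a}
  ... | yes (a′ , fa′≡fa) = cong (gen u) (Mono⇒gen-injective f mono fa′≡fa)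
  ... | no ¬preimage      = ⊥-elim (¬preimage (a , refl))

  p*-lift-gen : ∀ w → (p *) (map lift-gen w) ≡ (v *) w
  p*-lift-gen w = trans (sym (map-∘ w)) (map-cong lift-gen-over-v w)

  lift : Hom Q X
  lift = record
    { gen = lift-gen
    ; rel = λ {w} {w′} r → rel-reflecting (map lift-gen w) (map lift-gen w′)
              (subst₂ (Rel Y) (sym (p*-lift-gen w)) (sym (p*-lift-gen w′)) (rel v r)) }

Mono⇒InC : ExcludedMiddle 0ℓ → ∀ {P Q} (f : Hom P Q) → Mono f → InC f
Mono⇒InC em f mono X Y p rlp u v sq = lift , lift-gen-extends-u , lift-gen-over-v
  where open MonoLift em f mono p rlp u v sq

mainTheorem17 : ExcludedMiddle 0ℓ → ∀ {P Q : RPres} (f : Hom P Q) →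
    (InC f × InW f)
    ⇔
    (Mono f
    × (∀ (a : Gen Q) → Σ _ λ u → Q ⊢ (f *) u ∼ [ a ])
    × (∀ u v → Q ⊢ (f *) u ∼ (f *) v → P ⊢ u ∼ v))
mainTheorem17 em {P} {Q} f = mk⇔ to from
  where
  to : InC f × InW f →
       Mono f × (∀ a → Σ _ λ u → Q ⊢ (f *) u ∼ [ a ]) × (∀ u v → Q ⊢ (f *) u ∼ (f *) v → P ⊢ u ∼ v)
  to (cof , _ , injective , surjective) =
      InC⇒Mono f cof
    , (λ a → proj₁ (surjective [ a ]) , proj₂ (surjective [ a ]) ∼refl)
    , (λ u v → injective)

  from : Mono f × (∀ a → Σ _ λ u → Q ⊢ (f *) u ∼ [ a ]) × (∀ u v → Q ⊢ (f *) u ∼ (f *) v → P ⊢ u ∼ v) →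
         InC f × InW f
  from (mono , gen-surj , reflects) =
      Mono⇒InC em f mono
    , *-cong f
    , (λ {u} {v} → reflects u v)
    , strictlySurjective⇒surjective ∼trans (*-cong f) (*-strictlySurjective f gen-surj)
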